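{- Let $\ell\ge 2$ be an integer. If $n$ is a positive integer power of $\ell+2$, then $f(2,\ell,n)\le \frac{1+\ell n}{\ell+1}$.
   Context: A tournament is an orientation of a complete graph. An arborescence is an oriented tree with a designated root such that every vertex of the tree is reachable from the root by a directed path in the tree; its depth is the length of a longest directed path in it. An edge-colored arborescence is path-monochromatic if every directed path in it is monochromatic. For a tournament $T$, $f_T(k,\ell)$ is the largest integer $m$ such that every $k$-edge coloring of $T$ (arbitrary assignment of one of $k$ colors to each edge) contains a path-monochromatic arborescence of depth at most $\ell$ with at least $m$ vertices. $f(k,\ell,n)$ is the minimum of $f_T(k,\ell)$ over all tournaments $T$ on $n$ vertices. Throughout, $\ell\ge 2$. -}

module Defs where

open import Data.Nat using (ℕ; suc; _≤_)
open import Data.Fin using (Fin)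
open import Data.Fin.Subset using (Subset; _∈_; ∣_∣)
open import Data.List using (List; [_]; _++_)
import Data.List.Membership.Propositional as LM
open import Data.Product using (Σ; _×_)
open import Data.Sum using (_⊎_)
open import Data.Empty using (⊥)
open import Relation.Nullary using (¬_)
open import Relation.Binary.PropositionalEquality using (_≡_; _≢_)

record Tournament (n : ℕ) : Set₁ where
  field
    arc     : Fin n → Fin n → Set
    irrefl  : ∀ i → ¬ arc i i
    total   : ∀ i j → i ≢ j → arc i j ⊎ arc j i
    antisym : ∀ i j → arc i j → arc j i → ⊥
open Tournament public

-- A k-edge-colouring: the colour of the arc u → v is  c u v
-- (values on non-arcs are irrelevant).
Coloring : ℕ → ℕ → Set
Coloring k n = Fin n → Fin n → Fin k

-- An arborescence in T: vertex set, root, and for every non-root vertex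
-- a parent (its in-neighbour in the tree) with an arc parent v → v in T.
-- 'level' is the distance from the root; it strictly increases along
-- tree edges, which guarantees the structure is an oriented tree in which
-- every vertex is reachable from the root.
record Arborescence {n : ℕ} (T : Tournament n) : Set where
  field
    verts      : Subset n
    root       : Fin n
    root∈      : root ∈ verts
    parent     : Fin n → Fin n
    level      : Fin n → ℕ
    level-root : level root ≡ 0
    parent-ok  : ∀ v → v ∈ verts → v ≢ root →
                 (parent v ∈ verts) × arc T (parent v) v × (suc (level (parent v)) ≡ level v)
open Arborescence public

module _ {n : ℕ} {T : Tournament n} (A : Arborescence T) where

  TreeEdge : Fin n → Fin n → Set
  TreeEdge u v = (v ∈ verts A) × (v ≢ root A) × (parent A v ≡ u)

  data DPath : Fin n → Fin n → Set where
    edge : ∀ {u v} → TreeEdge u v → DPath u v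
    _▸_  : ∀ {u v w} → DPath u v → TreeEdge v w → DPath u w

  pathColors : ∀ {k u v} → Coloring k n → DPath u v → List (Fin k)
  pathColors c (edge {u} {v} _) = [ c u v ]
  pathColors c (_▸_ {v = v} {w = w} p _) = pathColors c p ++ [ c v w ]

  DepthAtMost : ℕ → Set
  DepthAtMost ℓ = ∀ v → v ∈ verts A → level A v ≤ ℓ

  PathMonochromatic : ∀ {k} → Coloring k n → Set
  PathMonochromatic c = ∀ {u v} (p : DPath u v) {x y : Fin _} →
    x LM.∈ pathColors c p → y LM.∈ pathColors c p → x ≡ y

size : ∀ {n} {T : Tournament n} → Arborescence T → ℕ
size A = ∣ verts A ∣

-- f_T(k,ℓ) ≤ M : every m such that every k-edge colouring of T contains a
-- path-monochromatic arborescence of depth ≤ ℓ with ≥ m vertices satisfies m ≤ M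
-- (i.e. the largest such m is at most M).
fT≤ : ∀ {n} → Tournament n → ℕ → ℕ → ℕ → Set
fT≤ {n} T k ℓ M =
  ∀ m → (∀ (c : Coloring k n) → Σ (Arborescence T) λ A →
            DepthAtMost A ℓ × PathMonochromatic A c × (m ≤ size A))
      → m ≤ M

-- f(k,ℓ,n) ≤ M : the minimum of f_T(k,ℓ) over tournaments T on n vertices is ≤ M,
-- i.e. some tournament T on n vertices has f_T(k,ℓ) ≤ M.
f≤ : ℕ → ℕ → ℕ → ℕ → Set₁
f≤ k ℓ n M = Σ (Tournament n) λ T → fT≤ T k ℓ M

-- Since (ℓ + 2)^e ≡ 1 (mod ℓ + 1) we may write n = (1 + ℓg) + g. On the vertices 0, …, n − 1
-- let u beat v when u < v ≤ u + g or v + g < u, and colour each arc by whether it goes up.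
-- In a path-monochromatic arborescence with root r, the arcs along a root path are all
-- ascending or all descending. Ascending arcs have length at most g, so within depth ℓ they
-- stay in [r, r + ℓg]; descending arcs jump down by more than g, so they end below r − g.
-- Hence the g vertices just below r (cyclically) are missed, the arborescence has at most
-- 1 + ℓg vertices, and (ℓ + 1)(1 + ℓg) = 1 + ℓn.
module Submission where

open import Data.Nat
open import Data.Nat.Properties
open import Data.Nat.Solver using (module +-*-Solver)
open import Data.Fin as Fin using (Fin; zero; suc; toℕ)
open import Data.Fin.Properties using (toℕ-injective; toℕ<n)
open import Data.Fin.Subset using (Subset; _∈_; ∣_∣)
open import Data.Vec using ([]; _∷_; here; there)
open import Data.List.Relation.Unary.Any using (here; there)
open import Data.Bool using (true; false)
open import Data.Product using (Σ; _×_; _,_; proj₁; proj₂)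
open import Data.Sum using (_⊎_; inj₁; inj₂; [_,_]′)
open import Data.Empty using (⊥)
open import Function using (_∘_; _⇔_; mk⇔; Equivalence)
open import Level using (0ℓ)
open import Relation.Nullary using (¬_; Dec; yes; no; contradiction)
open import Relation.Nullary.Decidable using (_×-dec_; _⊎-dec_)
open import Relation.Unary using (Pred; Decidable)
open import Relation.Binary.Definitions using (tri<; tri≈; tri>)
open import Relation.Binary.PropositionalEquality

open import Defs

module Counting {P : Pred ℕ 0ℓ} (P? : Decidable P) where

  count : ℕ → ℕ → ℕ
  count a zero = 0
  count a (suc n) with P? a
  ... | yes _ = suc (count (suc a) n)
  ... | no  _ = count (suc a) n

  private
    shift : ∀ {a n x} {p : Subset n} → (∀ i → i ∈ x ∷ p → P (a + toℕ i)) →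
            ∀ i → i ∈ p → P (suc a + toℕ i)
    shift {a} h i i∈p = subst P (+-suc a (toℕ i)) (h (suc i) (there i∈p))

  ∣p∣≤count : ∀ {n} a (p : Subset n) → (∀ i → i ∈ p → P (a + toℕ i)) → ∣ p ∣ ≤ count a n
  ∣p∣≤count a [] _ = z≤n
  ∣p∣≤count a (x ∷ p) h with P? a
  ∣p∣≤count a (true  ∷ p) h | yes _  = s≤s (∣p∣≤count (suc a) p (shift h))
  ∣p∣≤count a (false ∷ p) h | yes _  = m≤n⇒m≤1+n (∣p∣≤count (suc a) p (shift h))
  ∣p∣≤count a (true  ∷ p) h | no ¬Pa = contradiction (subst P (+-identityʳ a) (h zero here)) ¬Pa
  ∣p∣≤count a (false ∷ p) h | no _   = ∣p∣≤count (suc a) p (shift h)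

  count≤length : ∀ a n → count a n ≤ n
  count≤length a zero = z≤n
  count≤length a (suc n) with P? a
  ... | yes _ = s≤s (count≤length (suc a) n)
  ... | no  _ = m≤n⇒m≤1+n (count≤length (suc a) n)

  count-+ : ∀ a m n → count a (m + n) ≡ count a m + count (a + m) n
  count-+ a zero n = cong (λ b → count b n) (sym (+-identityʳ a))
  count-+ a (suc m) n rewrite +-suc a m with P? a
  ... | yes _ = cong suc (count-+ (suc a) m n)
  ... | no  _ = count-+ (suc a) m n

  count-none : ∀ a n → (∀ j → a ≤ j → j < a + n → ¬ P j) → count a n ≡ 0
  count-none a zero _ = refl
  count-none a (suc n) h with P? a
  ... | yes Pa = contradiction Pa (h a ≤-refl (m<m+n a z<s))
  ... | no  _  = count-none (suc a) n λ j a<j j<1+a+n →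
                   h j (<⇒≤ a<j) (subst (j <_) (sym (+-suc a n)) j<1+a+n)

  count-avoiding : ∀ a w b → (∀ j → P j → j < a ⊎ a + w ≤ j) → count 0 (a + (w + b)) ≤ a + b
  count-avoiding a w b outside = begin
    count 0 (a + (w + b))               ≡⟨ count-+ 0 a (w + b) ⟩
    count 0 a + count a (w + b)         ≡⟨ cong (count 0 a +_) (count-+ a w b) ⟩
    count 0 a + (count a w + count (a + w) b)
                                        ≡⟨ cong (λ k → count 0 a + (k + count (a + w) b)) gap ⟩
    count 0 a + count (a + w) b         ≤⟨ +-mono-≤ (count≤length 0 a) (count≤length (a + w) b) ⟩
    a + b                               ∎
    where
    open ≤-Reasoning
    gap : count a w ≡ 0
    gap = count-none a w λ j a≤j j<a+w Pj →
      [ (λ j<a → <⇒≱ j<a a≤j) , (λ a+w≤j → <⇒≱ j<a+w a+w≤j) ]′ (outside j Pj)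

  count-within : ∀ a w b → (∀ j → P j → a ≤ j × j < a + w) → count 0 (a + (w + b)) ≤ w
  count-within a w b inside = begin
    count 0 (a + (w + b))               ≡⟨ count-+ 0 a (w + b) ⟩
    count 0 a + count a (w + b)         ≡⟨ cong₂ _+_ before (count-+ a w b) ⟩
    count a w + count (a + w) b         ≡⟨ cong (count a w +_) after ⟩
    count a w + 0                       ≡⟨ +-identityʳ (count a w) ⟩
    count a w                           ≤⟨ count≤length a w ⟩
    w                                   ∎
    where
    open ≤-Reasoning
    before : count 0 a ≡ 0
    before = count-none 0 a λ j _ j<a Pj → <⇒≱ j<a (proj₁ (inside j Pj))
    after : count (a + w) b ≡ 0
    after = count-none (a + w) b λ j a+w≤j _ Pj → <⇒≱ (proj₂ (inside j Pj)) a+w≤j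

Near : ℕ → ℕ → ℕ → Pred ℕ 0ℓ
Near s g r j = (r ≤ j × j < r + s) ⊎ (j + g < r)

near? : ∀ s g r → Decidable (Near s g r)
near? s g r j = (r ≤? j ×-dec j <? r + s) ⊎-dec (j + g <? r)

-- Read cyclically modulo s + g, the g points just below r are never near r.
count-near≤ : ∀ s g r n → n ≡ s + g → r ≤ n → Counting.count (near? s g r) 0 n ≤ s
count-near≤ s g r n n≡s+g r≤n with g ≤? r
... | yes g≤r = begin
    count 0 n              ≡⟨ cong (count 0) split ⟩
    count 0 (a + (g + b))  ≤⟨ count-avoiding a g b avoid ⟩
    a + b                  ≡⟨ a+b≡s ⟩
    s                      ∎
  where
  open Counting (near? s g r)
  open ≤-Reasoning
  a b : ℕ
  a = r ∸ g
  b = n ∸ r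
  a+g≡r : a + g ≡ r
  a+g≡r = m∸n+n≡m g≤r
  split : n ≡ a + (g + b)
  split = begin-equality
    n             ≡⟨ sym (m+[n∸m]≡n r≤n) ⟩
    r + b         ≡⟨ cong (_+ b) (sym a+g≡r) ⟩
    a + g + b     ≡⟨ +-assoc a g b ⟩
    a + (g + b)   ∎
  a+b≡s : a + b ≡ s
  a+b≡s = +-cancelʳ-≡ g (a + b) s (begin-equality
    a + b + g     ≡⟨ +-assoc a b g ⟩
    a + (b + g)   ≡⟨ cong (a +_) (+-comm b g) ⟩
    a + (g + b)   ≡⟨ sym split ⟩
    n             ≡⟨ n≡s+g ⟩
    s + g         ∎)
  avoid : ∀ j → Near s g r j → j < a ⊎ a + g ≤ j
  avoid j (inj₁ (r≤j , _)) = inj₂ (subst (_≤ j) (sym a+g≡r) r≤j)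
  avoid j (inj₂ j+g<r)     = inj₁ (+-cancelʳ-< g j a (subst (j + g <_) (sym a+g≡r) j+g<r))
... | no g≰r = begin
    count 0 n              ≡⟨ cong (count 0) split ⟩
    count 0 (r + (s + c))  ≤⟨ count-within r s c within ⟩
    s                      ∎
  where
  open Counting (near? s g r)
  open ≤-Reasoning
  open +-*-Solver
  c : ℕ
  c = g ∸ r
  split : n ≡ r + (s + c)
  split = begin-equality
    n             ≡⟨ n≡s+g ⟩
    s + g         ≡⟨ cong (s +_) (sym (m+[n∸m]≡n (<⇒≤ (≰⇒> g≰r)))) ⟩
    s + (r + c)   ≡⟨ solve 3 (λ s r c → s :+ (r :+ c) := r :+ (s :+ c)) refl s r c ⟩
    r + (s + c)   ∎
  within : ∀ j → Near s g r j → r ≤ j × j < r + s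
  within j (inj₁ inside)  = inside
  within j (inj₂ j+g<r) = contradiction (≤-trans (m≤n+m g j) (<⇒≤ j+g<r)) g≰r

module WindowTournament (g : ℕ) where

  Beats : ℕ → ℕ → Set
  Beats a b = (a < b × b ≤ a + g) ⊎ (b + g < a)

  Beats-irrefl : ∀ a → ¬ Beats a a
  Beats-irrefl a (inj₁ (a<a , _)) = <-irrefl refl a<a
  Beats-irrefl a (inj₂ a+g<a)     = <-irrefl refl (≤-<-trans (m≤m+n a g) a+g<a)

  Beats-asym : ∀ a b → Beats a b → Beats b a → ⊥
  Beats-asym a b (inj₁ (a<b , _))     (inj₁ (b<a , _))     = <-asym a<b b<a
  Beats-asym a b (inj₁ (_ , b≤a+g))   (inj₂ a+g<b)         = <⇒≱ a+g<b b≤a+g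
  Beats-asym a b (inj₂ b+g<a)         (inj₁ (_ , a≤b+g))   = <⇒≱ b+g<a a≤b+g
  Beats-asym a b (inj₂ b+g<a)         (inj₂ a+g<b)         =
    <-asym (≤-<-trans (m≤m+n a g) a+g<b) (≤-<-trans (m≤m+n b g) b+g<a)

  Beats-total : ∀ a b → a ≢ b → Beats a b ⊎ Beats b a
  Beats-total a b a≢b with <-cmp a b
  ... | tri≈ _ a≡b _ = contradiction a≡b a≢b
  ... | tri< a<b _ _ with b ≤? a + g
  ...   | yes b≤a+g = inj₁ (inj₁ (a<b , b≤a+g))
  ...   | no  b≰a+g = inj₂ (inj₂ (≰⇒> b≰a+g))
  Beats-total a b a≢b | tri> _ _ b<a with a ≤? b + g
  ...   | yes a≤b+g = inj₂ (inj₁ (b<a , a≤b+g))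
  ...   | no  a≰b+g = inj₁ (inj₂ (≰⇒> a≰b+g))

  tournament : ∀ n → Tournament n
  tournament n = record
    { arc     = λ u v → Beats (toℕ u) (toℕ v)
    ; irrefl  = λ u → Beats-irrefl (toℕ u)
    ; total   = λ u v u≢v → Beats-total (toℕ u) (toℕ v) (u≢v ∘ toℕ-injective)
    ; antisym = λ u v → Beats-asym (toℕ u) (toℕ v)
    }

colourOf : ∀ {P : Set} → Dec P → Fin 2
colourOf (yes _) = zero
colourOf (no  _) = suc zero

colourOf-≡ : ∀ {P Q : Set} (P? : Dec P) (Q? : Dec Q) → colourOf P? ≡ colourOf Q? → P ⇔ Q
colourOf-≡ (yes p) (yes q) _ = mk⇔ (λ _ → q) (λ _ → p)
colourOf-≡ (no ¬p) (no ¬q) _ = mk⇔ (λ p → contradiction p ¬p) (λ q → contradiction q ¬q)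

ascending : ∀ {n} → Coloring 2 n
ascending u v = colourOf (toℕ u <? toℕ v)

module Sides {g n : ℕ} (A : Arborescence (WindowTournament.tournament g n))
             (mono : PathMonochromatic A ascending) where
  open WindowTournament g

  r : ℕ
  r = toℕ (root A)

  Ascends : Fin n → Set
  Ascends v = toℕ (parent A v) < toℕ v

  AboveRoot : Fin n → Set
  AboveRoot v = r ≤ toℕ v × toℕ v ≤ r + level A v * g

  data Side (v : Fin n) : Set where
    above : Ascends v → AboveRoot v → Side v
    below : ¬ Ascends v → toℕ v + g < r → Side v

  root-above : ∀ {p} → p ≡ root A → AboveRoot p
  root-above refl = ≤-refl , subst (λ l → r ≤ r + l * g) (sym (level-root A)) (m≤m+n r 0)

  ascend : ∀ {v} → AboveRoot (parent A v) → Ascends v → Beats (toℕ (parent A v)) (toℕ v) →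
           suc (level A (parent A v)) ≡ level A v → Side v
  ascend {v} (r≤p , p≤) p<v (inj₁ (_ , v≤p+g)) lev = above p<v (≤-trans r≤p (<⇒≤ p<v) , v≤)
    where
    open ≤-Reasoning
    p : Fin n
    p = parent A v
    v≤ : toℕ v ≤ r + level A v * g
    v≤ = begin
      toℕ v                       ≤⟨ v≤p+g ⟩
      toℕ p + g                   ≤⟨ +-monoˡ-≤ g p≤ ⟩
      r + level A p * g + g       ≡⟨ +-assoc r (level A p * g) g ⟩
      r + (level A p * g + g)     ≡⟨ cong (r +_) (+-comm (level A p * g) g) ⟩
      r + suc (level A p) * g     ≡⟨ cong (λ l → r + l * g) lev ⟩
      r + level A v * g           ∎
  ascend {v} _ p<v (inj₂ v+g<p) _ = contradiction p<v (<-asym (≤-<-trans (m≤m+n (toℕ v) g) v+g<p))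

  descend : ∀ {v} → toℕ (parent A v) ≤ r → ¬ Ascends v → Beats (toℕ (parent A v)) (toℕ v) → Side v
  descend _   p≮v (inj₁ (p<v , _)) = contradiction p<v p≮v
  descend p≤r p≮v (inj₂ v+g<p)     = below p≮v (<-≤-trans v+g<p p≤r)

  same-direction : ∀ {v} → v ∈ verts A → v ≢ root A → parent A v ∈ verts A → parent A v ≢ root A →
                   Ascends (parent A v) ⇔ Ascends v
  same-direction v∈ v≢r p∈ p≢r = colourOf-≡ _ _
    (mono (edge (p∈ , p≢r , refl) ▸ (v∈ , v≢r , refl)) (here refl) (there (here refl)))

  inherit : ∀ {v} → Ascends (parent A v) ⇔ Ascends v → Beats (toℕ (parent A v)) (toℕ v) →
            suc (level A (parent A v)) ≡ level A v → Side (parent A v) → Side v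
  inherit same p→v lev (above pp<p p-above) = ascend p-above (Equivalence.to same pp<p) p→v lev
  inherit same p→v _   (below pp≮p p+g<r)   =
    descend (<⇒≤ (≤-<-trans (m≤m+n _ g) p+g<r)) (pp≮p ∘ Equivalence.from same) p→v

  side : ∀ k v → level A v ≡ k → v ∈ verts A → v ≢ root A → Side v
  side k v lv v∈ v≢r with parent-ok A v v∈ v≢r
  side zero    v lv v∈ v≢r | _ , _ , lev = contradiction (trans lev lv) λ ()
  side (suc k) v lv v∈ v≢r | p∈ , p→v , lev with parent A v Fin.≟ root A | toℕ (parent A v) <? toℕ v
  ... | yes p≡r | yes p<v = ascend (root-above p≡r) p<v p→v lev
  ... | yes p≡r | no  p≮v = descend (≤-reflexive (cong toℕ p≡r)) p≮v p→v
  ... | no  p≢r | _       = inherit (same-direction v∈ v≢r p∈ p≢r) p→v lev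
                              (side k (parent A v) (suc-injective (trans lev lv)) p∈ p≢r)

  verts-near : ∀ {ℓ} → DepthAtMost A ℓ → ∀ v → v ∈ verts A → Near (suc (ℓ * g)) g r (toℕ v)
  verts-near {ℓ} dep v v∈ with v Fin.≟ root A
  ... | yes refl = inj₁ (≤-refl , m<m+n r z<s)
  ... | no  v≢r with side _ v refl v∈ v≢r
  ...   | above _ (r≤v , v≤) = inj₁ (r≤v , ≤-<-trans (≤-trans v≤ deeper) (+-monoʳ-< r (n<1+n _)))
    where
    deeper : r + level A v * g ≤ r + ℓ * g
    deeper = +-monoʳ-≤ r (*-monoˡ-≤ g (dep v v∈))
  ...   | below _ v+g<r       = inj₂ v+g<r

size≤ : ∀ ℓ g n → n ≡ suc (ℓ * g) + g → (A : Arborescence (WindowTournament.tournament g n)) →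
        DepthAtMost A ℓ → PathMonochromatic A ascending → size A ≤ suc (ℓ * g)
size≤ ℓ g n n≡ A dep mono = ≤-trans
  (Counting.∣p∣≤count (near? s g r) 0 (verts A) (verts-near dep))
  (count-near≤ s g r n n≡ (<⇒≤ (toℕ<n (root A))))
  where
  open Sides A mono
  s : ℕ
  s = suc (ℓ * g)

[ℓ+2]^e≡1+ℓg+g : ∀ ℓ e → Σ ℕ λ g → (ℓ + 2) ^ e ≡ suc (ℓ * g) + g
[ℓ+2]^e≡1+ℓg+g ℓ zero = 0 , cong suc (sym (trans (+-identityʳ (ℓ * 0)) (*-zeroʳ ℓ)))
[ℓ+2]^e≡1+ℓg+g ℓ (suc e) with [ℓ+2]^e≡1+ℓg+g ℓ e
... | g , eq = suc ((ℓ + 2) * g) , trans (cong ((ℓ + 2) *_) eq)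
    (solve 2 (λ ℓ g → (ℓ :+ con 2) :* (con 1 :+ ℓ :* g :+ g)
                     := con 1 :+ ℓ :* (con 1 :+ (ℓ :+ con 2) :* g) :+ (con 1 :+ (ℓ :+ con 2) :* g)) refl ℓ g)
  where open +-*-Solver

lemma1 : ∀ (ℓ : ℕ) → 2 ≤ ℓ → ∀ (e : ℕ) → 1 ≤ e → ∀ (n : ℕ) → n ≡ (ℓ + 2) ^ e →
         Σ ℕ λ M → f≤ 2 ℓ n M × (suc ℓ * M ≤ 1 + ℓ * n)
lemma1 ℓ _ e _ n n≡ with [ℓ+2]^e≡1+ℓg+g ℓ e
... | g , eq = suc (ℓ * g) , (tournament n , bound) , ≤-reflexive identity
  where
  open WindowTournament g
  bound : fT≤ (tournament n) 2 ℓ (suc (ℓ * g))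
  bound m every with every ascending
  ... | A , dep , mono , m≤size = ≤-trans m≤size (size≤ ℓ g n (trans n≡ eq) A dep mono)
  identity : suc ℓ * suc (ℓ * g) ≡ 1 + ℓ * n
  identity rewrite n≡ | eq =
    solve 2 (λ ℓ g → (con 1 :+ ℓ) :* (con 1 :+ ℓ :* g) := con 1 :+ ℓ :* (con 1 :+ ℓ :* g :+ g)) refl ℓ g
    where open +-*-Solver
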